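{- Let $l$ be a link with $\mathit{source}(l)=i$, $\mathit{dest}(l)=j$, $i\neq j$, and $a$ an action. For all interpretations $I$ such that $\varphi$ is an $i$-formula and $t$ is an $i$-term in $I$, if $\varphi$ satisfies the principle of excluded middle with respect to $I$, then $Fair\text{ - }Pg(\varphi,t,l,a)$ is consistent with respect to $I$, i.e. $S_I(Fair\text{ - }Pg(\varphi,t,l,a))\neq\emptyset$.
   Context: All reasoning is constructive (Nuprl). $\varphi$ satisfies the principle of excluded middle w.r.t. $I$ if $\varphi\vee\neg\varphi$ is constructively provable in $I$. Event structures: an event structure $es$ has agents, links $l$ with $\mathit{source}(l)$ and $\mathit{dest}(l)$, local actions, local variables $X_i$ per agent (with $\mathit{msg}(l)\in X_i$ when $\mathit{source}(l)=i$; sending $m$ on $l$ means setting $\mathit{msg}(l)$ to $m\neq\bot$), initial local states $\mathit{initstate}_i$, and events $e$ with agent, kind $\mathit{rcv}(l)$ or $\mathit{local}(a)$, value $\mathit{val}(e)$; $\mathit{state\ before}\ e$, $\mathit{state\ after}\ e$ are the agent's local states around $e$; receive events on $l$ have send events $\mathit{send}(e)$ with $\mathit{val}(e)=\mathit{msg}(l)\ \mathit{after}\ \mathit{send}(e)$; events of agent $i$ are totally ordered by $\prec_i$ (reflexive closure $\succeq_i$); the causal order is well-founded. $\forall e@i\in es.\ \phi$ quantifies over events of $i$. An interpretation $I$ fixes meanings of symbols; $I(\varphi)(s)$ means $\varphi$ is constructively provable at state $s$; $\varphi$ is an $i$-formula if its truth depends only on $i$'s local state; $t$ is an $i$-term if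 its value depends only on $i$'s local state. Basic programs for agent $i$ and consistency with $es$ under $I$: $@i\ \mathit{kind}=\mathit{local}(a)\ \mathtt{only\ if}\ \varphi$: every event $e$ of $i$ of kind $\mathit{local}(a)$ has $I(\varphi)(\mathit{state\ before}\ e)$ (and $\varphi$ is an $i$-formula); $@i\ \mathtt{if}\ \mathit{kind}=k\ \mathtt{then}\ x:=t$: each event $e$ of $i$ of kind $k$ has $(\mathit{state\ after}\ e)(x)=I(t)(\mathit{state\ before}\ e)$ (and $t$ is an $i$-term); $@i\ \mathtt{only}\ L\ \mathtt{affects}\ \mathit{msg}(l)$: each event $e$ of $i$ with $\mathit{msg}(l)\ \mathit{after}\ e\neq\bot$ has kind in $L$; $@i\ \mathtt{if\ necessarily}\ \varphi\ \mathtt{then\ i.o.}\ \mathit{kind}=\mathit{local}(a)$: $\varphi$ is an $i$-formula and either ($i$ has some event and $\forall e@i\in es.\ \exists e'\succeq_i e.\ I(\neg\varphi)(\mathit{state\ after}\ e')\vee\mathit{kind}(e')=\mathit{local}(a)$) or ($i$ has no event and $I(\neg\varphi)(\mathit{initstate}_i)$). Consistency with $Pg_1\oplus Pg_2$ means consistency with both. $S_I(Pg)$ is the set of event structures consistent with $Pg$ under $I$. $Fair\text{ - }Pg(\varphi,t,l,a)=@i\ \mathit{kind}=\mathit{local}(a)\ \mathtt{only\ if}\ \varphi\ \oplus\ @i\ \mathtt{if}\ \mathit{kind}=\mathit{local}(a)\ \mathtt{then}\ \mathit{msg}(l):=t\ \oplus\ @i\ \mathtt{only}\ [a]\ \mathtt{affects}\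 \mathit{msg}(l)\ \oplus\ @i\ \mathtt{if\ necessarily}\ \varphi\ \mathtt{then\ i.o.}\ \mathit{kind}=\mathit{local}(a)$. -}

module Defs where

open import Level using (0ℓ)
open import Data.Maybe using (Maybe; just; nothing)
open import Data.Product using (Σ; ∃; _×_; _,_)
open import Data.Sum using (_⊎_)
open import Data.List using (List; _∷_; [])
open import Data.List.Membership.Propositional using (_∈_)
open import Relation.Nullary using (¬_)
open import Relation.Binary.PropositionalEquality using (_≡_; _≢_)
open import Relation.Binary.Construct.Closure.Transitive using (TransClosure)
open import Induction.WellFounded using (WellFounded)
open import Function.Bundles using (_⇔_)

-- Signature: agents, links, actions, local variables, values.
-- X_i = { x | owner x ≡ i };  msg(l) ∈ X_{source l};  ⊥v is "no message".

record Sig : Set₁ where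
  field
    Agent Link Action Var Val : Set
    source dest : Link → Agent
    owner       : Var → Agent
    msg         : Link → Var
    msg-owner   : ∀ l → owner (msg l) ≡ source l
    ⊥v          : Val

module _ (S : Sig) where
  open Sig S

  data Kind : Set where
    rcv   : Link → Kind
    local : Action → Kind

  -- A state assigns values to variables; the local state of agent i
  -- is its restriction to X_i.
  State : Set
  State = Var → Val

  SameLocal : Agent → State → State → Set
  SameLocal i s s' = ∀ x → owner x ≡ i → s x ≡ s' x

  -- φ is an i-formula / t is an i-term (interpreted formulas are
  -- predicates on states, read constructively as types of proofs)
  IsFormula : Agent → (State → Set) → Set
  IsFormula i φ = ∀ s s' → SameLocal i s s' → (φ s ⇔ φ s')

  IsTerm : Agent → (State → Val) → Set
  IsTerm i t = ∀ s s' → SameLocal i s s' → t s ≡ t s'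

  ExcludedMiddle : (State → Set) → Set
  ExcludedMiddle φ = ∀ s → φ s ⊎ ¬ φ s

  record RawES : Set₁ where
    field
      E       : Set
      loc     : E → Agent
      kind    : E → Kind
      val     : E → Val
      pred    : E → Maybe E
      send    : (e : E) (l : Link) → kind e ≡ rcv l → E
      before  : E → State
      after   : E → State
      init    : Agent → State

  module _ (R : RawES) where
    open RawES R

    PredStep : E → E → Set
    PredStep e' e = pred e ≡ just e'

    data CausalStep : E → E → Set where
      viaPred : ∀ {e' e} → pred e ≡ just e' → CausalStep e' e
      viaSend : ∀ {e} l (k : kind e ≡ rcv l) → CausalStep (send e l k) e

    _≺_ : E → E → Set
    _≺_ = TransClosure PredStep

    _causes_ : E → E → Set
    _causes_ = TransClosure CausalStep

    _≼_ : E → E → Set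
    e ≼ e' = e ≡ e' ⊎ e ≺ e'

    record IsES : Set where
      field
        pred-loc    : ∀ e e' → pred e ≡ just e' → loc e' ≡ loc e
        total       : ∀ e e' → loc e ≡ loc e' → e ≺ e' ⊎ (e ≡ e' ⊎ e' ≺ e)
        causal-wf   : WellFounded _causes_
        rcv-loc     : ∀ e l → kind e ≡ rcv l → loc e ≡ dest l
        send-loc    : ∀ e l (k : kind e ≡ rcv l) → loc (send e l k) ≡ source l
        send-val    : ∀ e l (k : kind e ≡ rcv l) →
                        val e ≡ after (send e l k) (msg l)
        send-nonbot : ∀ e l (k : kind e ≡ rcv l) →
                        after (send e l k) (msg l) ≢ ⊥v
        first-state : ∀ e → pred e ≡ nothing →
                        SameLocal (loc e) (before e) (init (loc e))
        pred-state  : ∀ e e' → pred e ≡ just e' →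
                        SameLocal (loc e) (before e) (after e')

  record ES : Set₁ where
    field
      raw  : RawES
      isES : IsES raw
    open RawES raw public

  data Program : Set₁ where
    -- @i kind = local(a) only if φ
    onlyIf      : Agent → Action → (State → Set) → Program
    -- @i if kind = k then x := t
    ifThen      : Agent → Kind → Var → (State → Val) → Program
    -- @i only L affects msg(l)
    onlyAffects : Agent → List Kind → Link → Program
    -- @i if necessarily φ then i.o. kind = local(a)
    ifNecIO     : Agent → (State → Set) → Action → Program
    _⊕_         : Program → Program → Program

  Consistent : ES → Program → Set
  Consistent es (onlyIf i a φ) =
    IsFormula i φ ×
    (∀ e → ES.loc es e ≡ i → ES.kind es e ≡ local a → φ (ES.before es e))
  Consistent es (ifThen i k x t) =
    IsTerm i t ×
    (∀ e → ES.loc es e ≡ i → ES.kind es e ≡ k →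
       ES.after es e x ≡ t (ES.before es e))
  Consistent es (onlyAffects i L l) =
    ∀ e → ES.loc es e ≡ i → ES.after es e (msg l) ≢ ⊥v → ES.kind es e ∈ L
  Consistent es (ifNecIO i φ a) =
    IsFormula i φ ×
    ( ( (Σ (ES.E es) λ e → ES.loc es e ≡ i) ×
        (∀ e → ES.loc es e ≡ i →
           Σ (ES.E es) λ e' → ES.loc es e' ≡ i × _≼_ (ES.raw es) e e' ×
             (¬ φ (ES.after es e') ⊎ ES.kind es e' ≡ local a)) )
    ⊎ ( ¬ (Σ (ES.E es) λ e → ES.loc es e ≡ i) × ¬ φ (ES.init es i) ) )
  Consistent es (p ⊕ q) = Consistent es p × Consistent es q

  IsConsistent : Program → Set₁
  IsConsistent pg = Σ ES λ es → Consistent es pg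

  Fair-Pg : (State → Set) → (State → Val) → Link → Action → Program
  Fair-Pg φ t l a =
    onlyIf (source l) a φ ⊕
    (ifThen (source l) (local a) (msg l) t ⊕
    (onlyAffects (source l) (local a ∷ []) l ⊕
     ifNecIO (source l) φ a))

module Submission where

-- Let i = source(l).  Consistency is witnessed by the run in
-- which agent i performs action a as long as the guard φ holds, and
-- nothing else happens.  Starting from the state s₀ in which every
-- variable is ⊥, the run is s₀, s₁, s₂, … with s_{n+1} obtained by
-- performing msg(l) := t(s_n).  Excluded middle for φ lets us decide, for
-- every n, whether φ held at s₀, …, s_n; the events are exactly those
-- indices n, so the events form an initial segment of ℕ (empty precisely
-- when φ fails at s₀, as "if necessarily" demands).

open import Defs
open import Relation.Binary.PropositionalEquality using (_≢_; _≡_; refl; cong)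
open import Level using (0ℓ)
open import Relation.Binary.Core using (Rel)
open import Relation.Binary.Definitions using (tri<; tri≈; tri>)
open import Relation.Binary.Construct.Closure.Transitive using (TransClosure; [_]; _∷_; _∷ʳ_)
open import Relation.Nullary using (¬_)
open import Relation.Nullary.Decidable using (isYes; fromSum; toWitness; fromWitness)
open import Induction.WellFounded using (WellFounded; module Subrelation)
open import Data.Nat using (ℕ; zero; suc; _<_; s≤s)
open import Data.Nat.Properties using (<-trans; <-cmp; n<1+n; m≤n⇒m<n∨m≡n)
open import Data.Nat.Induction using (<-wellFounded)
open import Data.Bool using (Bool; T; _∧_)
open import Data.Bool.Properties using (T-irrelevant; T-∧)
open import Data.Maybe using (Maybe; just; nothing)
open import Data.Product using (Σ; _×_; _,_; proj₁; proj₂)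
open import Data.Sum using (_⊎_; inj₁; inj₂)
open import Data.List using (_∷_; [])
open import Data.List.Relation.Unary.Any using (here)
open import Function.Bundles using (Equivalence)
import Relation.Binary.Construct.On as On

closure-wellFounded : {A : Set} {R : Rel A 0ℓ} (measure : A → ℕ) →
  (∀ {x y} → R x y → measure x < measure y) →
  WellFounded (TransClosure R)
closure-wellFounded {R = R} measure increases =
  Subrelation.wellFounded closure-increases (On.wellFounded measure <-wellFounded)
  where
  closure-increases : ∀ {x y} → TransClosure R x y → measure x < measure y
  closure-increases [ r ]     = increases r
  closure-increases (r ∷ rs) = <-trans (increases r) (closure-increases rs)

module InitialSegment (inside : ℕ → Bool)
                      (inside-pred : ∀ n → T (inside (suc n)) → T (inside n)) where

  Point : Set
  Point = Σ ℕ (λ n → T (inside n))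

  point : ∀ n → T (inside n) → Point
  point = _,_

  -- Points are determined by their index, since T b has at most one proof.
  point-≡ : ∀ n (p q : T (inside n)) → point n p ≡ point n q
  point-≡ n p q with T-irrelevant p q
  ... | refl = refl

  prev : Point → Maybe Point
  prev (zero  , _) = nothing
  prev (suc n , p) = just (n , inside-pred n p)

  _⋖_ : Rel Point 0ℓ
  _⋖_ = TransClosure (λ x y → prev y ≡ just x)

  prev-decreases : ∀ {x y} → prev y ≡ just x → proj₁ x < proj₁ y
  prev-decreases {y = suc n , _} refl = n<1+n n

  <⇒⋖ : ∀ {m n} (p : T (inside m)) (q : T (inside n)) → m < n → point m p ⋖ point n q
  <⇒⋖ {m} {suc n} p q (s≤s m≤n) with m≤n⇒m<n∨m≡n m≤n
  ... | inj₁ m<n  = <⇒⋖ p (inside-pred n q) m<n ∷ʳ refl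
  ... | inj₂ refl = [ cong just (point-≡ m (inside-pred m q) p) ]

  ⋖-trichotomy : ∀ x y → x ⋖ y ⊎ (x ≡ y ⊎ y ⋖ x)
  ⋖-trichotomy (m , p) (n , q) with <-cmp m n
  ... | tri< m<n _ _ = inj₁ (<⇒⋖ p q m<n)
  ... | tri≈ _ refl _ = inj₂ (inj₁ (point-≡ m p q))
  ... | tri> _ _ n<m = inj₂ (inj₂ (<⇒⋖ q p n<m))

module FairRun (S : Sig) (l : Sig.Link S) (a : Sig.Action S)
               (φ : State S → Set) (t : State S → Sig.Val S)
               (em : ExcludedMiddle S φ) where
  open Sig S

  s₀ : State S
  s₀ _ = ⊥v

  -- Variables have no decidable equality, so performing msg(l) := t
  -- overwrites every variable with t's value; only msg(l) is constrained.
  run : ℕ → State S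
  run zero    = s₀
  run (suc n) = λ _ → t (run n)

  alive : ℕ → Bool
  alive zero    = isYes (fromSum (em s₀))
  alive (suc n) = alive n ∧ isYes (fromSum (em (run (suc n))))

  alive-pred : ∀ n → T (alive (suc n)) → T (alive n)
  alive-pred n alive-sn = proj₁ (Equivalence.to (T-∧ {alive n}) alive-sn)

  alive⇒φ : ∀ n → T (alive n) → φ (run n)
  alive⇒φ zero    alive-0  = toWitness alive-0
  alive⇒φ (suc n) alive-sn =
    toWitness {a? = fromSum (em (run (suc n)))} (proj₂ (Equivalence.to (T-∧ {alive n}) alive-sn))

  alive⇒alive₀ : ∀ n → T (alive n) → T (alive zero)
  alive⇒alive₀ zero    alive-0  = alive-0
  alive⇒alive₀ (suc n) alive-sn = alive⇒alive₀ n (alive-pred n alive-sn)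

  open InitialSegment alive alive-pred

  -- Event n is the (n+1)-st execution of a; it leads from run n to run (n+1).
  raw : RawES S
  raw = record
    { E = Point ; loc = λ _ → source l ; kind = λ _ → local a ; val = λ _ → ⊥v
    ; pred = prev ; send = λ _ _ () ; before = λ e → run (proj₁ e)
    ; after = λ e → run (suc (proj₁ e)) ; init = λ _ → s₀ }

  -- Every causal step is a local predecessor step: there are no receives.
  causal-increases : ∀ {x y} → CausalStep S raw x y → proj₁ x < proj₁ y
  causal-increases (viaPred prev≡x) = prev-decreases prev≡x
  causal-increases (viaSend _ ())

  isES : IsES S raw
  isES = record
    { pred-loc = λ _ _ _ → refl
    ; total = λ x y _ → ⋖-trichotomy x y
    ; causal-wf = closure-wellFounded proj₁ causal-increases
    ; rcv-loc = λ _ _ ()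
    ; send-loc = λ _ _ ()
    ; send-val = λ _ _ ()
    ; send-nonbot = λ _ _ ()
    ; first-state = first-state
    ; pred-state = pred-state }
    where
    first-state : ∀ (e : Point) → prev e ≡ nothing → SameLocal S (source l) (run (proj₁ e)) s₀
    first-state (zero , _) _ _ _ = refl
    pred-state : ∀ (e e' : Point) → prev e ≡ just e' →
                 SameLocal S (source l) (run (proj₁ e)) (run (suc (proj₁ e')))
    pred-state (suc n , _) _ refl _ _ = refl

  es : ES S
  es = record { raw = raw ; isES = isES }

  -- @i kind = local(a) only if φ: every event lies in the alive prefix.
  guard-respected : ∀ e → ES.loc es e ≡ source l → ES.kind es e ≡ local a →
                    φ (ES.before es e)
  guard-respected (n , alive-n) _ _ = alive⇒φ n alive-n

  assignment-performed : ∀ e → ES.loc es e ≡ source l → ES.kind es e ≡ local a →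
                         ES.after es e (msg l) ≡ t (ES.before es e)
  assignment-performed _ _ _ = refl

  only-a-affects : Consistent S es (onlyAffects (source l) (local a ∷ []) l)
  only-a-affects _ _ _ = here refl

  -- @i if necessarily φ then i.o. a: if φ(s₀) then event 0 exists and
  -- every event is itself an a-event; otherwise there are no events.
  fires-while-enabled : IsFormula S (source l) φ → Consistent S es (ifNecIO (source l) φ a)
  fires-while-enabled φ-local = φ-local , by-initial-guard (em s₀)
    where
    HasEvent : Set
    HasEvent = Σ (ES.E es) (λ e → ES.loc es e ≡ source l)
    by-initial-guard : φ s₀ ⊎ ¬ φ s₀ →
      (HasEvent × (∀ e → ES.loc es e ≡ source l →
         Σ (ES.E es) λ e' → ES.loc es e' ≡ source l × _≼_ S (ES.raw es) e e' ×
           (¬ φ (ES.after es e') ⊎ ES.kind es e' ≡ local a)))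
      ⊎ (¬ HasEvent × ¬ φ (ES.init es (source l)))
    by-initial-guard (inj₁ φ₀) =
      inj₁ (((zero , fromWitness φ₀) , refl) , λ e _ → e , refl , inj₁ refl , inj₂ refl)
    by-initial-guard (inj₂ ¬φ₀) =
      inj₂ ((λ { ((n , alive-n) , _) → ¬φ₀ (alive⇒φ zero (alive⇒alive₀ n alive-n)) }) , ¬φ₀)

lemma2p9 : (S : Sig) (l : Sig.Link S) (a : Sig.Action S) →
    Sig.source S l ≢ Sig.dest S l →
    (φ : State S → Set) (t : State S → Sig.Val S) →
    IsFormula S (Sig.source S l) φ → IsTerm S (Sig.source S l) t →
    ExcludedMiddle S φ →
    IsConsistent S (Fair-Pg S φ t l a)
lemma2p9 S l a _ φ t φ-local t-local em =
  es , (φ-local , guard-respected)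
     , ((t-local , assignment-performed)
     , (only-a-affects
     , fires-while-enabled φ-local))
  where open FairRun S l a φ t em
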